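{- Let $\lambda$ be a partition and $\pi$ a reverse plane partition of shape $\lambda$ that is not identically zero. Then $\mathrm{cand}(\pi)\neq\emptyset$.
   Context: Cells are pairs $(i,j)\in\mathbb Z^2$; $\mathrm n(i,j)=(i-1,j)$, $\mathrm e(i,j)=(i,j+1)$, $\mathrm s(i,j)=(i+1,j)$, $\mathrm w(i,j)=(i,j-1)$. A partition $\lambda$ is identified with its Young diagram. A reverse plane partition of shape $\lambda$ is $\pi:\lambda\to\mathbb N$ with $\pi(u)\le\pi(\mathrm e u),\pi(\mathrm s u)$, with conventions $\pi(i,j)=0$ if $i\le0$ or $j\le0$ and $\pi(i,j)=\infty$ if $i,j\ge1$, $(i,j)\notin\lambda$. Content $c(i,j)=j-i$. Outer corner: $u\in\lambda$, $\mathrm e u,\mathrm s u\notin\lambda$; inner corner: $\mathrm e u,\mathrm s u\in\lambda$, $\mathrm e\mathrm s u\notin\lambda$. With inner corner contents $i_1<\dots<i_r$ and outer corner contents $o_1<\dots<o_{r+1}$ (interlacing $o_1<i_1<o_2<\dots<i_r<o_{r+1}$), let $\mathcal O=\{u\in\lambda:c(u)=o_k\text{ some }k\}$ and $\mathcal A=\{u\in\lambda:c(u)<o_1\text{ or }i_k<c(u)<o_{k+1}\text{ some }k\in[r]\}$. Candidates: $\mathrm{cand}(\pi)=\{u\in\mathcal O:\pi(u)>\pi(\mathrm w u)\}\cup\{u\in\mathcal A:\pi(u)>\pi(\mathrm w u),\ \pi(u)>\pi(\mathrm n u)\}$. -}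

module Defs where

open import Data.Nat using (ℕ; zero; suc; _≤_; _<_)
open import Data.Integer as ℤ using (ℤ; +_; _-_)
open import Data.List using (List; []; _∷_)
open import Data.List.Relation.Unary.Linked using (Linked)
open import Data.List.Relation.Unary.All using (All)
open import Data.Fin as Fin using (Fin)
open import Data.Product using (_×_; _,_; ∃; Σ)
open import Data.Sum using (_⊎_)
open import Function.Bundles using (_⇔_)
open import Relation.Binary.PropositionalEquality using (_≡_)
open import Relation.Nullary using (¬_)

record Partition : Set where
  field
    parts : List ℕ
    decr  : Linked (λ a b → b ≤ a) parts
    pos   : All (λ a → 0 < a) parts
open Partition public

nth0 : List ℕ → ℕ → ℕ
nth0 [] _ = 0
nth0 (x ∷ xs) zero = x
nth0 (x ∷ xs) (suc i) = nth0 xs i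

-- length of row i (1-based); 0 for i = 0 and for i > ℓ
row : Partition → ℕ → ℕ
row p zero = 0
row p (suc i) = nth0 (parts p) i

-- Cells (i , j).  Only cells with i, j ≥ 0 are ever needed (north/west of a
-- cell of λ), so we use ℕ × ℕ.
Cell : Set
Cell = ℕ × ℕ

_∈Y_ : Cell → Partition → Set
(i , j) ∈Y p = (1 ≤ i) × (1 ≤ j) × (j ≤ row p i)

north east south west : Cell → Cell
north (i , j) = (i Data.Nat.∸ 1 , j)
east  (i , j) = (i , suc j)
south (i , j) = (suc i , j)
west  (i , j) = (i , j Data.Nat.∸ 1)

val : (Cell → ℕ) → Cell → ℕ
val π (zero , j) = 0
val π (suc i , zero) = 0
val π (suc i , suc j) = π (suc i , suc j)

-- reverse plane partition of shape p (only values on cells of p matter;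
-- the ∞ convention outside p makes the conditions vacuous there)
IsRPP : Partition → (Cell → ℕ) → Set
IsRPP p π = ∀ u → u ∈Y p →
  (east u ∈Y p → π u ≤ π (east u)) × (south u ∈Y p → π u ≤ π (south u))

content : Cell → ℤ
content (i , j) = + j - + i

IsOuterCorner : Partition → Cell → Set
IsOuterCorner p u = u ∈Y p × ¬ (east u ∈Y p) × ¬ (south u ∈Y p)

IsInnerCorner : Partition → Cell → Set
IsInnerCorner p u = east u ∈Y p × south u ∈Y p × ¬ (east (south u) ∈Y p)

StrictlyIncreasing : ∀ {n} → (Fin n → ℤ) → Set
StrictlyIncreasing f = ∀ k l → k Fin.< l → f k ℤ.< f l

Enumerates : ∀ {n} → (Cell → Set) → (Fin n → ℤ) → Set
Enumerates P f = ∀ x → (∃ λ u → P u × content u ≡ x) ⇔ (∃ λ k → f k ≡ x)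

-- ι = (i₁ < … < i_r) inner corner contents, o = (o₁ < … < o_{r+1}) outer
-- corner contents (0-based indices: ι k = i_{k+1}, o k = o_{k+1})
IsCornerEnum : Partition → (r : ℕ) → (Fin r → ℤ) → (Fin (suc r) → ℤ) → Set
IsCornerEnum p r ι o =
  StrictlyIncreasing ι × Enumerates (IsInnerCorner p) ι ×
  StrictlyIncreasing o × Enumerates (IsOuterCorner p) o

module _ (p : Partition) {r : ℕ} (ι : Fin r → ℤ) (o : Fin (suc r) → ℤ) where

  InO : Cell → Set
  InO u = u ∈Y p × ∃ λ k → content u ≡ o k

  InA : Cell → Set
  InA u = u ∈Y p ×
    (content u ℤ.< o Fin.zero ⊎
     ∃ λ (k : Fin r) → ι k ℤ.< content u × content u ℤ.< o (Fin.suc k))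

  InCand : (Cell → ℕ) → Cell → Set
  InCand π u =
    (InO u × val π (west u) < val π u) ⊎
    (InA u × val π (west u) < val π u × val π (north u) < val π u)

-- The zero cells of π form an order ideal of λ.  Take a column y whose
-- bottom cell (C , y) is nonzero while column y − 1 vanishes down to row C,
-- and let (t + 1 , y) be the topmost nonzero cell of column y.  Every cell
-- of column y between rows t + 1 and C exceeds its western neighbour, and
-- (t + 1 , y) also its northern one.  The contents of these cells run
-- through [y − C , y − t − 1].  If this interval reaches the content R − C
-- of the outer corner ending row C, the cell with that content lies in O.
-- Otherwise all of it lies strictly between the inner corner ending row
-- C + 1 and the outer corner ending row C, which are consecutive corners
-- because inner and outer corner contents interlace; so (t + 1 , y) ∈ A.
module Submission where

open import Defs
open import Data.Nat using (ℕ; suc)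
open import Data.Integer using (ℤ)
open import Data.Fin using (Fin)
open import Data.Product using (_×_; ∃)
open import Relation.Binary.PropositionalEquality using (_≢_)

open import Data.Nat as ℕ
  using (zero; _≤_; _<_; _≤′_; ≤′-refl; ≤′-step; z≤n; s≤s; _+_; _∸_; _≤?_; _≟_)
import Data.Nat.Properties as ℕP
open import Data.Integer as ℤ using (_⊖_)
import Data.Integer.Properties as ℤP
open import Data.Fin as Fin using (inject₁; toℕ)
import Data.Fin.Properties as FinP
open import Data.Fin.Induction using (<-weakInduction)
open import Data.List using ([]; _∷_; length)
open import Data.List.Relation.Unary.Linked using (Linked; []; [-]; _∷_)
open import Data.Product using (_,_; proj₁; proj₂; ∃₂)
open import Data.Sum using (_⊎_; inj₁; inj₂)
open import Data.Empty using (⊥-elim)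
open import Relation.Nullary using (yes; no)
open import Relation.Binary.Definitions using (tri<; tri≈; tri>)
open import Relation.Binary.PropositionalEquality
  using (_≡_; refl; sym; trans; cong; cong₂; subst; subst₂; module ≡-Reasoning)
open import Function.Bundles using (Equivalence)

content-over : ∀ k i j → content (i , j) ≡ (j + k) ⊖ (i + k)
content-over k i j = begin
  ℤ.+ j ℤ.- ℤ.+ i         ≡⟨ ℤP.m-n≡m⊖n j i ⟩
  j ⊖ i                   ≡⟨ sym (ℤP.+-cancelˡ-⊖ k j i) ⟩
  (k + j) ⊖ (k + i)       ≡⟨ cong₂ _⊖_ (ℕP.+-comm k j) (ℕP.+-comm k i) ⟩
  (j + k) ⊖ (i + k)       ∎
  where open ≡-Reasoning

content-over′ : ∀ i i' j' → content (i' , j') ≡ (j' + i) ⊖ (i + i')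
content-over′ i i' j' = trans (content-over i i' j') (cong ((j' + i) ⊖_) (ℕP.+-comm i' i))

content-≤ : ∀ i j i' j' → j + i' ≤ j' + i → content (i , j) ℤ.≤ content (i' , j')
content-≤ i j i' j' h =
  subst₂ ℤ._≤_ (sym (content-over i' i j)) (sym (content-over′ i i' j')) (ℤP.⊖-monoˡ-≤ (i + i') h)

content-< : ∀ i j i' j' → j + i' < j' + i → content (i , j) ℤ.< content (i' , j')
content-< i j i' j' h =
  subst₂ ℤ._<_ (sym (content-over i' i j)) (sym (content-over′ i i' j')) (ℤP.⊖-monoˡ-< (i + i') h)

content-≡ : ∀ i j i' j' → j + i' ≡ j' + i → content (i , j) ≡ content (i' , j')
content-≡ i j i' j' h =
  trans (content-over i' i j) (trans (cong (_⊖ (i + i')) h) (sym (content-over′ i i' j')))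

module _ {n : ℕ} {f : Fin n → ℤ} (f↑ : StrictlyIncreasing f) where

  strictlyIncreasing⇒monotone : ∀ {k l} → k Fin.≤ l → f k ℤ.≤ f l
  strictlyIncreasing⇒monotone {k} {l} k≤l with k Fin.≟ l
  ... | yes refl = ℤP.≤-refl
  ... | no k≢l = ℤP.<⇒≤ (f↑ k l (FinP.≤∧≢⇒< k≤l k≢l))

  strictlyIncreasing-reflects-< : ∀ {k l} → f k ℤ.< f l → k Fin.< l
  strictlyIncreasing-reflects-< {k} {l} fk<fl with FinP.<-cmp k l
  ... | tri< k<l _ _ = k<l
  ... | tri≈ _ refl _ = ⊥-elim (ℤP.<-irrefl refl fk<fl)
  ... | tri> _ _ l<k = ⊥-elim (ℤP.<-asym fk<fl (f↑ l k l<k))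

interlacing : ∀ {r} {f : Fin r → ℤ} {g : Fin (suc r) → ℤ} → StrictlyIncreasing f →
  (∀ k → ∃ λ j → g (inject₁ k) ℤ.< f j × f j ℤ.< g (Fin.suc k)) →
  ∀ k → f k ℤ.< g (Fin.suc k)
interlacing {zero} f↑ separates ()
interlacing {suc r} {f} {g} f↑ separates =
  <-weakInduction (λ k → f k ℤ.< g (Fin.suc k)) base step
  where
  base : f Fin.zero ℤ.< g (Fin.suc Fin.zero)
  base with separates Fin.zero
  ... | j , _ , fj<g1 = ℤP.≤-<-trans (strictlyIncreasing⇒monotone f↑ z≤n) fj<g1

  step : ∀ k → f (inject₁ k) ℤ.< g (Fin.suc (inject₁ k)) → f (Fin.suc k) ℤ.< g (Fin.suc (Fin.suc k))
  step k fk<gk+1 with separates (Fin.suc k)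
  ... | j , gk+1<fj , fj<gk+2 = ℤP.≤-<-trans (strictlyIncreasing⇒monotone f↑ k+1≤j) fj<gk+2
    where
    k+1≤j : Fin.suc k Fin.≤ j
    k+1≤j = subst (λ m → suc m ≤ toℕ j) (FinP.toℕ-inject₁ k)
      (strictlyIncreasing-reflects-< f↑ (ℤP.<-trans fk<gk+1 gk+1<fj))

zero-then-nonzero : (f : ℕ → ℕ) → f 0 ≡ 0 → ∀ n → f n ≢ 0 →
  ∃ λ m → m < n × f m ≡ 0 × f (suc m) ≢ 0
zero-then-nonzero f f0≡0 zero fn≢0 = ⊥-elim (fn≢0 f0≡0)
zero-then-nonzero f f0≡0 (suc n) fn+1≢0 with f n ≟ 0
... | yes fn≡0 = n , ℕP.n<1+n n , fn≡0 , fn+1≢0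
... | no fn≢0 with zero-then-nonzero f f0≡0 n fn≢0
...   | m , m<n , fm≡0 , fm+1≢0 = m , ℕP.m<n⇒m<1+n m<n , fm≡0 , fm+1≢0

nth0-step : ∀ {xs} → Linked (λ a b → b ≤ a) xs → ∀ i → nth0 xs (suc i) ≤ nth0 xs i
nth0-step [] i = z≤n
nth0-step [-] i = z≤n
nth0-step (y≤x ∷ _) zero = y≤x
nth0-step (_ ∷ decr) (suc i) = nth0-step decr i

nth0-beyond : ∀ xs {i} → length xs ≤ i → nth0 xs i ≡ 0
nth0-beyond [] _ = refl
nth0-beyond (x ∷ xs) {suc i} (s≤s h) = nth0-beyond xs h

module Shape (p : Partition) where

  row-step : ∀ {i} → 1 ≤ i → row p (suc i) ≤ row p i
  row-step {suc i} _ = nth0-step (decr p) i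

  row-antitone : ∀ {i i'} → 1 ≤ i → i ≤ i' → row p i' ≤ row p i
  row-antitone {i} 1≤i i≤i' = go (ℕP.≤⇒≤′ i≤i')
    where
    go : ∀ {i'} → i ≤′ i' → row p i' ≤ row p i
    go ≤′-refl = ℕP.≤-refl
    go (≤′-step h) = ℕP.≤-trans (row-step (ℕP.≤-trans 1≤i (ℕP.≤′⇒≤ h))) (go h)

  ∈Y-up : ∀ {x x' y} → 1 ≤ x → x ≤ x' → (x' , y) ∈Y p → (x , y) ∈Y p
  ∈Y-up 1≤x x≤x' (_ , 1≤y , y≤row) = 1≤x , 1≤y , ℕP.≤-trans y≤row (row-antitone 1≤x x≤x')

  ∈Y-left : ∀ {x y y'} → 1 ≤ y' → y' ≤ y → (x , y) ∈Y p → (x , y') ∈Y p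
  ∈Y-left 1≤y' y'≤y (1≤x , _ , y≤row) = 1≤x , 1≤y' , ℕP.≤-trans y'≤y y≤row

  IsColumnBottom : Cell → Set
  IsColumnBottom (C , y) = (C , y) ∈Y p × row p (suc C) < y

  column-bottom-within : ∀ k {a b} → length (parts p) ≤ k + a → (a , b) ∈Y p →
    ∃ λ C → a ≤ C × IsColumnBottom (C , b)
  column-bottom-within k {a} {b} bound a,b∈ with b ≤? row p (suc a)
  ... | no b≰ = a , ℕP.≤-refl , a,b∈ , ℕP.≰⇒> b≰
  column-bottom-within zero {a} bound (_ , 1≤b , _) | yes b≤ =
    ⊥-elim (ℕP.<-irrefl refl (ℕP.≤-trans 1≤b (subst (_ ≤_) (nth0-beyond (parts p) bound) b≤)))
  column-bottom-within (suc k) {a} bound (_ , 1≤b , _) | yes b≤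
    with column-bottom-within k (subst (length (parts p) ≤_) (sym (ℕP.+-suc k a)) bound) (s≤s z≤n , 1≤b , b≤)
  ... | C , a<C , bottom = C , ℕP.<⇒≤ a<C , bottom

  column-bottom : ∀ {a b} → (a , b) ∈Y p → ∃ λ C → a ≤ C × IsColumnBottom (C , b)
  column-bottom = column-bottom-within (length (parts p)) (ℕP.m≤m+n _ _)

  outer-corner-row : ∀ {x y} → IsOuterCorner p (x , y) → row p x ≤ y
  outer-corner-row ((1≤x , _ , _) , ¬east , _) = ℕP.≮⇒≥ λ y<row → ¬east (1≤x , s≤s z≤n , y<row)

  outer-corner-is-column-bottom : ∀ {x y} → IsOuterCorner p (x , y) → IsColumnBottom (x , y)
  outer-corner-is-column-bottom (x,y∈@(_ , 1≤y , _) , _ , ¬south) =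
    x,y∈ , ℕP.≰⇒> λ y≤row → ¬south (s≤s z≤n , 1≤y , y≤row)

  row-end-is-outer-corner : ∀ {C y} → IsColumnBottom (C , y) → IsOuterCorner p (C , row p C)
  row-end-is-outer-corner ((1≤C , 1≤y , y≤R) , s<y) =
    (1≤C , ℕP.≤-trans 1≤y y≤R , ℕP.≤-refl) ,
    (λ (_ , _ , R<R) → ℕP.<-irrefl refl R<R) ,
    (λ (_ , _ , R≤s) → ℕP.<⇒≱ (ℕP.<-≤-trans s<y y≤R) R≤s)

  row-below-end-is-inner-corner : ∀ {C y} → IsColumnBottom (C , y) → 1 ≤ row p (suc C) →
    IsInnerCorner p (C , row p (suc C))
  row-below-end-is-inner-corner ((1≤C , _ , y≤R) , s<y) 1≤s =
    (1≤C , s≤s z≤n , ℕP.<-≤-trans s<y y≤R) ,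
    (s≤s z≤n , 1≤s , ℕP.≤-refl) ,
    (λ (_ , _ , s<s) → ℕP.<-irrefl refl s<s)

  outer-corner-dichotomy : ∀ {x y} C → IsOuterCorner p (x , y) →
    content (C , row p C) ℤ.≤ content (x , y) ⊎
    (1 ≤ row p (suc C) × content (x , y) ℤ.< content (C , row p (suc C)))
  outer-corner-dichotomy {x} {y} C corner@((1≤x , 1≤y , y≤row) , _ , _) with x ≤? C
  ... | yes x≤C = inj₁ (content-≤ C (row p C) x y
          (ℕP.+-mono-≤ (ℕP.≤-trans (row-antitone 1≤x x≤C) (outer-corner-row corner)) x≤C))
  ... | no x≰C = inj₂ (ℕP.≤-trans 1≤y y≤s , content-< x y C (row p (suc C)) (ℕP.+-mono-≤-< y≤s C<x))
    where
    C<x : C < x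
    C<x = ℕP.≰⇒> x≰C
    y≤s : y ≤ row p (suc C)
    y≤s = ℕP.≤-trans y≤row (row-antitone (s≤s z≤n) C<x)

  inner-corner-between-outer-corners : ∀ {x y x' y'} →
    IsOuterCorner p (x , y) → IsOuterCorner p (x' , y') → content (x , y) ℤ.< content (x' , y') →
    ∃ λ u → IsInnerCorner p u × content (x , y) ℤ.< content u × content u ℤ.< content (x' , y')
  inner-corner-between-outer-corners {x} {y} {x'} {y'} corner corner' c<c' =
    (x' , t) ,
    row-below-end-is-inner-corner bottom' (ℕP.≤-trans (proj₁ (proj₂ (proj₁ corner))) y≤t) ,
    content-< x y x' t (ℕP.+-mono-≤-< y≤t x'<x) ,
    content-< x' t x' y' (ℕP.+-monoˡ-< x' t<y')
    where
    t : ℕ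
    t = row p (suc x')
    bottom' : IsColumnBottom (x' , y')
    bottom' = outer-corner-is-column-bottom corner'
    t<y' : t < y'
    t<y' = proj₂ bottom'
    x'<x : x' < x
    x'<x = ℕP.≰⇒> λ x≤x' → ℤP.<⇒≱ c<c' (content-≤ x' y' x y (ℕP.+-mono-≤ (y'≤y x≤x') x≤x'))
      where
      y'≤y : x ≤ x' → y' ≤ y
      y'≤y x≤x' = ℕP.≤-trans (proj₂ (proj₂ (proj₁ corner')))
        (ℕP.≤-trans (row-antitone (proj₁ (proj₁ corner)) x≤x') (outer-corner-row corner))
    y≤t : y ≤ t
    y≤t = ℕP.≤-trans (proj₂ (proj₂ (proj₁ corner))) (row-antitone (s≤s z≤n) x'<x)

module Corners (p : Partition) {r : ℕ} (ι : Fin r → ℤ) (o : Fin (suc r) → ℤ)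
               (E : IsCornerEnum p r ι o) where
  open Shape p

  private
    ι↑ : StrictlyIncreasing ι
    ι↑ = proj₁ E
    ι-enum : Enumerates (IsInnerCorner p) ι
    ι-enum = proj₁ (proj₂ E)
    o↑ : StrictlyIncreasing o
    o↑ = proj₁ (proj₂ (proj₂ E))
    o-enum : Enumerates (IsOuterCorner p) o
    o-enum = proj₂ (proj₂ (proj₂ E))

  outer-corner-at : ∀ k → ∃ λ u → IsOuterCorner p u × content u ≡ o k
  outer-corner-at k = Equivalence.from (o-enum (o k)) (k , refl)

  outer-corner-index : ∀ {u} → IsOuterCorner p u → ∃ λ k → o k ≡ content u
  outer-corner-index {u} corner = Equivalence.to (o-enum (content u)) (u , corner , refl)

  inner-corner-index : ∀ {u} → IsInnerCorner p u → ∃ λ k → ι k ≡ content u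
  inner-corner-index {u} corner = Equivalence.to (ι-enum (content u)) (u , corner , refl)

  inner-below-next-outer : ∀ k → ι k ℤ.< o (Fin.suc k)
  inner-below-next-outer = interlacing {g = o} ι↑ separates
    where
    separates : ∀ k → ∃ λ j → o (inject₁ k) ℤ.< ι j × ι j ℤ.< o (Fin.suc k)
    separates k with outer-corner-at (inject₁ k) | outer-corner-at (Fin.suc k)
    ... | u , corner , u≡ | v , corner' , v≡ with inner-corner-between-outer-corners corner corner'
            (subst₂ ℤ._<_ (sym u≡) (sym v≡) (o↑ (inject₁ k) (Fin.suc k) k<k+1))
      where
      k<k+1 : inject₁ k Fin.< Fin.suc k
      k<k+1 = s≤s (ℕP.≤-reflexive (FinP.toℕ-inject₁ k))
    ... | w , inner , u<w , w<v with inner-corner-index inner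
    ... | j , ιj≡ = j , subst₂ ℤ._<_ u≡ (sym ιj≡) u<w , subst₂ ℤ._<_ (sym ιj≡) v≡ w<v

  InAWindow : ℤ → Set
  InAWindow c = c ℤ.< o Fin.zero ⊎ ∃ λ k → ι k ℤ.< c × c ℤ.< o (Fin.suc k)

  -- The end of row C + 1 (an inner corner, or the boundary if that row is
  -- empty) and the end of row C are consecutive in the interlacing.
  column-bottom-to-row-end-in-A-window : ∀ {C y c} → IsColumnBottom (C , y) →
    content (C , y) ℤ.≤ c → c ℤ.< content (C , row p C) → InAWindow c
  column-bottom-to-row-end-in-A-window {C} {y} {c} bottom@(_ , s<y) cb≤c c<end
    with outer-corner-at Fin.zero
  ... | u , corner , u≡ with outer-corner-dichotomy C corner
  ...   | inj₁ end≤u = inj₁ (subst (c ℤ.<_) u≡ (ℤP.<-≤-trans c<end end≤u))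
  ...   | inj₂ (1≤s , _) with inner-corner-index (row-below-end-is-inner-corner bottom 1≤s)
  ...     | j , ιj≡ = inj₂ (j , ιj<c , c<o[j+1])
    where
    s : ℕ
    s = row p (suc C)
    ιj<c : ι j ℤ.< c
    ιj<c = subst (ℤ._< c) (sym ιj≡)
      (ℤP.<-≤-trans (content-< C s C y (ℕP.+-monoˡ-< C s<y)) cb≤c)
    c<o[j+1] : c ℤ.< o (Fin.suc j)
    c<o[j+1] with outer-corner-at (Fin.suc j)
    ... | v , corner' , v≡ with outer-corner-dichotomy C corner'
    ...   | inj₁ end≤v = subst (c ℤ.<_) v≡ (ℤP.<-≤-trans c<end end≤v)
    ...   | inj₂ (_ , v<s) =
      ⊥-elim (ℤP.<-asym (inner-below-next-outer j) (subst₂ ℤ._<_ v≡ (sym ιj≡) v<s))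

module Entries (p : Partition) (π : Cell → ℕ) (rpp : IsRPP p π) where
  open Shape p

  val-∈Y : ∀ {x y} → (x , y) ∈Y p → val π (x , y) ≡ π (x , y)
  val-∈Y {suc x} {suc y} _ = refl

  val-south-mono : ∀ {x y} → (suc x , y) ∈Y p → val π (x , y) ≤ val π (suc x , y)
  val-south-mono {zero} _ = z≤n
  val-south-mono {suc x} {suc y} x+1,y∈ =
    proj₂ (rpp (suc x , suc y) (∈Y-up (s≤s z≤n) (ℕP.n≤1+n _) x+1,y∈)) x+1,y∈

  val-column-mono : ∀ {x x' y} → x ≤ x' → (x' , y) ∈Y p → val π (x , y) ≤ val π (x' , y)
  val-column-mono x≤x' = go (ℕP.≤⇒≤′ x≤x')
    where
    go : ∀ {x x' y} → x ≤′ x' → (x' , y) ∈Y p → val π (x , y) ≤ val π (x' , y)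
    go ≤′-refl _ = ℕP.≤-refl
    go (≤′-step {n = zero} ≤′-refl) _ = z≤n
    go (≤′-step {n = suc x'} h) x',y∈ =
      ℕP.≤-trans (go h (∈Y-up (s≤s z≤n) (ℕP.n≤1+n _) x',y∈)) (val-south-mono x',y∈)

  val-nonzero-downward : ∀ {x x' y} → x ≤ x' → (x' , y) ∈Y p → val π (x , y) ≢ 0 → val π (x' , y) ≢ 0
  val-nonzero-downward x≤x' x',y∈ nonzero zero-below =
    nonzero (ℕP.n≤0⇒n≡0 (subst (_ ≤_) zero-below (val-column-mono x≤x' x',y∈)))

  nonzero-bottom-with-zero-west : ∀ b {C} → IsColumnBottom (C , suc b) → val π (C , suc b) ≢ 0 →
    ∃₂ λ C' y' → IsColumnBottom (C' , y') × val π (C' , y') ≢ 0 ×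
                 (∀ x → x ≤ C' → val π (west (x , y')) ≡ 0)
  nonzero-bottom-with-zero-west zero {C} bottom nonzero =
    C , 1 , bottom , nonzero , λ { zero _ → refl ; (suc x) _ → refl }
  nonzero-bottom-with-zero-west (suc b) {C} bottom nonzero with val π (C , suc b) ≟ 0
  ... | yes zero-west =
    C , suc (suc b) , bottom , nonzero ,
    λ x x≤C → ℕP.n≤0⇒n≡0 (subst (_ ≤_) zero-west (val-column-mono x≤C C,b+1∈))
    where
    C,b+1∈ : (C , suc b) ∈Y p
    C,b+1∈ = ∈Y-left (s≤s z≤n) (ℕP.n≤1+n _) (proj₁ bottom)
  ... | no nonzero-west with column-bottom (∈Y-left (s≤s z≤n) (ℕP.n≤1+n _) (proj₁ bottom))
  ...   | C' , C≤C' , bottom' =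
    nonzero-bottom-with-zero-west b bottom' (val-nonzero-downward C≤C' (proj₁ bottom') nonzero-west)

module Column (p : Partition) (π : Cell → ℕ) (rpp : IsRPP p π)
              {r : ℕ} (ι : Fin r → ℤ) (o : Fin (suc r) → ℤ) (E : IsCornerEnum p r ι o)
              {C y t : ℕ} (bottom : Shape.IsColumnBottom p (C , y))
              (west-zero : ∀ x → x ≤ C → val π (west (x , y)) ≡ 0)
              (t<C : t < C) (north-zero : val π (t , y) ≡ 0) (top-nonzero : val π (suc t , y) ≢ 0)
              where
  open Shape p
  open Entries p π rpp
  open Corners p ι o E

  R : ℕ
  R = row p C

  segment-∈ : ∀ {x} → t < x → x ≤ C → (x , y) ∈Y p
  segment-∈ t<x x≤C = ∈Y-up (ℕP.≤-trans (s≤s z≤n) t<x) x≤C (proj₁ bottom)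

  exceeds-west : ∀ {x} → t < x → x ≤ C → val π (west (x , y)) < val π (x , y)
  exceeds-west {x} t<x x≤C = subst (_< val π (x , y)) (sym (west-zero x x≤C))
    (ℕP.<-≤-trans (ℕP.n≢0⇒n>0 top-nonzero) (val-column-mono t<x (segment-∈ t<x x≤C)))

  top-exceeds-north : val π (north (suc t , y)) < val π (suc t , y)
  top-exceeds-north = subst (_< val π (suc t , y)) (sym north-zero) (ℕP.n≢0⇒n>0 top-nonzero)

  candidate : ∃ λ u → InCand p ι o π u
  candidate with R + suc t ≤? y + C
  ... | no short =
    (suc t , y) ,
    inj₂ ((segment-∈ ℕP.≤-refl t<C , column-bottom-to-row-end-in-A-window bottom below-top top-below-R) ,
          exceeds-west ℕP.≤-refl t<C , top-exceeds-north)
    where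
    below-top : content (C , y) ℤ.≤ content (suc t , y)
    below-top = content-≤ C y (suc t) y (ℕP.+-monoʳ-≤ y t<C)
    top-below-R : content (suc t , y) ℤ.< content (C , R)
    top-below-R = content-< (suc t) y C R (ℕP.≰⇒> short)
  ... | yes reaches with outer-corner-index (row-end-is-outer-corner bottom)
  ...   | k , o≡ =
    (x , y) , inj₁ ((segment-∈ t<x x≤C , k , trans x-on-R (sym o≡)) , exceeds-west t<x x≤C)
    where
    x : ℕ
    x = (y + C) ∸ R
    t<x : t < x
    t<x = ℕP.m+n≤o⇒m≤o∸n (suc t) (subst (_≤ y + C) (ℕP.+-comm R (suc t)) reaches)
    x≤C : x ≤ C
    x≤C = ℕP.m≤n+o⇒m∸n≤o (y + C) R (ℕP.+-monoˡ-≤ C (proj₂ (proj₂ (proj₁ bottom))))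
    x-on-R : content (x , y) ≡ content (C , R)
    x-on-R = content-≡ x y C R (sym (ℕP.m+[n∸m]≡n (ℕP.≤-trans (ℕP.m≤m+n R (suc t)) reaches)))

mainTheorem3 : (p : Partition) (π : Cell → ℕ) → IsRPP p π →
    (∃ λ u → u ∈Y p × π u ≢ 0) →
    (r : ℕ) (ι : Fin r → ℤ) (o : Fin (suc r) → ℤ) → IsCornerEnum p r ι o →
    ∃ λ u → InCand p ι o π u
mainTheorem3 p π rpp ((a , zero) , (_ , () , _) , _) r ι o E
mainTheorem3 p π rpp ((a , suc b) , a,b∈ , nonzero) r ι o E =
  let C₀ , a≤C₀ , bottom₀ = column-bottom a,b∈
      C , y , bottom , bottom-nonzero , west-zero = nonzero-bottom-with-zero-west b bottom₀
        (val-nonzero-downward a≤C₀ (proj₁ bottom₀) (subst (_≢ 0) (sym (val-∈Y a,b∈)) nonzero))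
      t , t<C , north-zero , top-nonzero = zero-then-nonzero (λ x → val π (x , y)) refl C bottom-nonzero
  in Column.candidate p π rpp ι o E bottom west-zero t<C north-zero top-nonzero
  where
  open Shape p
  open Entries p π rpp
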